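{- For any graph $G$ without bridges and any signature $\sigma$ on $G$, $\Phi_c(G,\sigma)\le 2\,\Phi_c(G)$.
   Context: Graphs are finite, may have multiple edges but no loops; a signed graph $(G,\sigma)$ has $\sigma:E(G)\to\{+,-\}$. For an orientation $D$ and $f:E(G)\to\mathbb{R}$, $\partial_Df(v)$ is the sum of $f$ over out-arcs at $v$ minus the sum over in-arcs. A circular $r$-flow ($r\ge2$) in $(G,\sigma)$ is a pair $(D,f)$ with $f:E(G)\to(-r,r)$ such that $|f(e)|\in[1,r-1]$ for positive edges, $|f(e)|\in[0,\frac r2-1]\cup[\frac r2+1,r)$ for negative edges, and $\partial_Df(v)=0$ at every vertex; $\Phi_c(G,\sigma)$ is the infimum of $r$ for which such a flow exists. $\Phi_c(G)$ denotes $\Phi_c(G,+)$ where all edges are positive, i.e., the usual circular flow index of $G$.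
   Formalization: The parameter r and the flow values of circular r-flows, on both $(G,\sigma)$ and the all-positive graph, are rational rather than real. -}

module Defs where

open import Data.Nat using (ℕ; zero; suc)
open import Data.Fin using (Fin; zero; suc; _≟_)
open import Data.Product using (_×_; _,_; proj₁; proj₂; Σ; ∃)
open import Data.Sum using (_⊎_)
open import Data.Bool using (Bool; true; false; if_then_else_)
open import Relation.Binary.PropositionalEquality using (_≡_; _≢_)
open import Relation.Nullary using (¬_)
open import Relation.Nullary.Decidable using (does)
open import Data.Rational using (ℚ; 0ℚ; 1ℚ; _+_; _-_; _*_; -_; ∣_∣; ½; _≤_; _<_)

record Graph : Set where
  field
    n     : ℕ
    m     : ℕ
    ends  : Fin m → Fin n × Fin n
    loopless : ∀ e → proj₁ (ends e) ≢ proj₂ (ends e)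
open Graph public

data Sign : Set where
  pos neg : Sign

Signature : Graph → Set
Signature G = Fin (m G) → Sign

allPositive : (G : Graph) → Signature G
allPositive G _ = pos

data ConnWithout (G : Graph) (e : Fin (m G)) : Fin (n G) → Fin (n G) → Set where
  here : ∀ {u} → ConnWithout G e u u
  fwd  : ∀ {w} (e' : Fin (m G)) → e' ≢ e →
         ConnWithout G e (proj₂ (ends G e')) w → ConnWithout G e (proj₁ (ends G e')) w
  bwd  : ∀ {w} (e' : Fin (m G)) → e' ≢ e →
         ConnWithout G e (proj₁ (ends G e')) w → ConnWithout G e (proj₂ (ends G e')) w

IsBridge : (G : Graph) → Fin (m G) → Set
IsBridge G e = ¬ ConnWithout G e (proj₁ (ends G e)) (proj₂ (ends G e))

Bridgeless : Graph → Set
Bridgeless G = ∀ e → ¬ IsBridge G e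

-- An orientation: true means e is oriented from proj₁ (ends e) to proj₂ (ends e).
Orientation : Graph → Set
Orientation G = Fin (m G) → Bool

tailOf headOf : (G : Graph) → Orientation G → Fin (m G) → Fin (n G)
tailOf G D e = if D e then proj₁ (ends G e) else proj₂ (ends G e)
headOf G D e = if D e then proj₂ (ends G e) else proj₁ (ends G e)

sumFin : (k : ℕ) → (Fin k → ℚ) → ℚ
sumFin zero    g = 0ℚ
sumFin (suc k) g = g zero + sumFin k (λ i → g (suc i))

boundary : (G : Graph) → Orientation G → (Fin (m G) → ℚ) → Fin (n G) → ℚ
boundary G D f v =
  sumFin (m G) (λ e → if does (tailOf G D e ≟ v) then f e else 0ℚ)
  - sumFin (m G) (λ e → if does (headOf G D e ≟ v) then f e else 0ℚ)

EdgeOK : ℚ → Sign → ℚ → Set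
EdgeOK r pos x = (1ℚ ≤ ∣ x ∣) × (∣ x ∣ ≤ r - 1ℚ)
EdgeOK r neg x = ((∣ x ∣ ≤ r * ½ - 1ℚ) ⊎ (r * ½ + 1ℚ ≤ ∣ x ∣)) × (∣ x ∣ < r)

IsCircularFlow : (G : Graph) → Signature G → ℚ → Orientation G → (Fin (m G) → ℚ) → Set
IsCircularFlow G σ r D f =
  (∀ e → (- r < f e) × (f e < r) × EdgeOK r (σ e) (f e))
  × (∀ v → boundary G D f v ≡ 0ℚ)

HasCircularFlow : (G : Graph) → Signature G → ℚ → Set
HasCircularFlow G σ r =
  (1ℚ + 1ℚ ≤ r) × Σ (Orientation G) (λ D → Σ (Fin (m G) → ℚ) (λ f → IsCircularFlow G σ r D f))

{-# OPTIONS --safe #-}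
-- A circular r-flow (D, f) of (G, +) is already a circular 2r-flow of (G, σ)
-- for every signature σ: its values satisfy 1 ≤ |f e| ≤ r - 1, which is
-- admissible for positive edges at 2r and, as r - 1 = 2r/2 - 1, for negative
-- edges as well.
module Submission where

open import Defs
open import Data.Product using (_×_; Σ; _,_)
open import Data.Sum using (inj₁)
open import Data.Unit using (tt)
open import Data.Rational using (ℚ; 0ℚ; 1ℚ; _+_; _*_; _≤_; _<_; _-_; -_; ∣_∣; ½; _≤?_; _<?_)
open import Data.Rational.Properties
open import Relation.Binary.PropositionalEquality
open import Relation.Nullary.Decidable using (toWitness)

2ℚ : ℚ
2ℚ = 1ℚ + 1ℚ

0≤2 : 0ℚ ≤ 2ℚ
0≤2 = toWitness {a? = 0ℚ ≤? 2ℚ} tt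

p≤p+q : ∀ p {q} → 0ℚ ≤ q → p ≤ p + q
p≤p+q p 0≤q = subst (_≤ p + _) (+-identityʳ p) (+-monoʳ-≤ p 0≤q)

p-1<p : ∀ p → p - 1ℚ < p
p-1<p p = subst (p - 1ℚ <_) (+-identityʳ p) (+-monoʳ-< p (toWitness {a? = - 1ℚ <? 0ℚ} tt))

p≤2p : ∀ {p} → 0ℚ ≤ p → p ≤ 2ℚ * p
p≤2p {p} 0≤p = subst (p ≤_) (sym 2p≡p+p) (p≤p+q p 0≤p)
  where
  2p≡p+p : 2ℚ * p ≡ p + p
  2p≡p+p = trans (*-distribʳ-+ p 1ℚ 1ℚ) (cong₂ _+_ (*-identityˡ p) (*-identityˡ p))

2p*½≡p : ∀ p → 2ℚ * p * ½ ≡ p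
2p*½≡p p = begin
  2ℚ * p * ½   ≡⟨ cong (_* ½) (*-comm 2ℚ p) ⟩
  p * 2ℚ * ½   ≡⟨ *-assoc p 2ℚ ½ ⟩
  p * (2ℚ * ½) ≡⟨⟩
  p * 1ℚ       ≡⟨ *-identityʳ p ⟩
  p            ∎
  where open ≡-Reasoning

EdgeOK-pos⇒EdgeOK-double : ∀ {r x} → 0ℚ ≤ r → EdgeOK r pos x → (sg : Sign) → EdgeOK (2ℚ * r) sg x
EdgeOK-pos⇒EdgeOK-double {r} {x} 0≤r (1≤∣x∣ , ∣x∣≤r-1) pos =
  1≤∣x∣ , ≤-trans ∣x∣≤r-1 (+-monoˡ-≤ (- 1ℚ) (p≤2p 0≤r))
EdgeOK-pos⇒EdgeOK-double {r} {x} 0≤r (_ , ∣x∣≤r-1) neg =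
  inj₁ (subst (λ h → ∣ x ∣ ≤ h - 1ℚ) (sym (2p*½≡p r)) ∣x∣≤r-1) ,
  <-≤-trans (≤-<-trans ∣x∣≤r-1 (p-1<p r)) (p≤2p 0≤r)

IsCircularFlow-pos⇒IsCircularFlow-double :
  ∀ G {r D f} → 0ℚ ≤ r → IsCircularFlow G (allPositive G) r D f →
  (σ : Signature G) → IsCircularFlow G σ (2ℚ * r) D f
IsCircularFlow-pos⇒IsCircularFlow-double G {r} {f = f} 0≤r (edges , conservation) σ =
  edges-double , conservation
  where
  r≤2r : r ≤ 2ℚ * r
  r≤2r = p≤2p 0≤r
  edges-double : ∀ e → (- (2ℚ * r) < f e) × (f e < 2ℚ * r) × EdgeOK (2ℚ * r) (σ e) (f e)
  edges-double e with edges e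
  ... | -r<fe , fe<r , ok =
    ≤-<-trans (neg-antimono-≤ r≤2r) -r<fe , <-≤-trans fe<r r≤2r ,
    EdgeOK-pos⇒EdgeOK-double 0≤r ok (σ e)

HasCircularFlow-pos⇒HasCircularFlow-double :
  ∀ G {r} → HasCircularFlow G (allPositive G) r → (σ : Signature G) → HasCircularFlow G σ (2ℚ * r)
HasCircularFlow-pos⇒HasCircularFlow-double G {r} (2≤r , D , f , flow) σ =
  ≤-trans 2≤r (p≤2p 0≤r) , D , f , IsCircularFlow-pos⇒IsCircularFlow-double G {D = D} {f} 0≤r flow σ
  where
  0≤r : 0ℚ ≤ r
  0≤r = ≤-trans 0≤2 2≤r

proposition3p10 : (G : Graph) → Bridgeless G → (σ : Signature G) →
    (r : ℚ) → HasCircularFlow G (allPositive G) r →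
    (ε : ℚ) → 0ℚ < ε →
    Σ ℚ (λ s → (s ≤ (1ℚ + 1ℚ) * r + ε) × HasCircularFlow G σ s)
proposition3p10 G _ σ r flow ε 0<ε =
  2ℚ * r , p≤p+q (2ℚ * r) (<⇒≤ 0<ε) , HasCircularFlow-pos⇒HasCircularFlow-double G flow σ
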